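{- Let $\mathcal{T}$ be a tree on $n\ge 2$ vertices with geodesic distance sum $\mathcal{S}=\sum_{\{u,v\}}d(u,v)$ (over unordered pairs of distinct vertices). For an integer $t\ge 1$, let $\mathcal{T}'(t)$ be the tree obtained from $\mathcal{T}$ by applying the first-order subdivision $t$ times in succession, where the first-order subdivision of a tree inserts one new vertex into every edge (replaces every edge $uv$ by a path $u\,w\,v$ with a new vertex $w$). Then the geodesic distance sum of $\mathcal{T}'(t)$ is $$\mathcal{S}_{\mathcal{T}'(t)}=8^{t}\mathcal{S}-\frac{1}{3}\left(2^{3t}-2^{t}\right)(n-1)+\left(2^{2t-1}-2^{3t-1}\right)(n-1)^{2}.$$
   Context: The geodesic distance $d(u,v)$ between two vertices of a tree is the length (number of edges) of the unique path joining them. The geodesic distance sum of a tree is the sum of $d(u,v)$ over all unordered pairs $\{u,v\}$ of distinct vertices. -}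

module Defs where

open import Data.Nat using (ℕ; zero; suc; _+_; _≤_; _<ᵇ_)
open import Data.Fin using (Fin; toℕ; _↑ˡ_; _↑ʳ_)
open import Data.Product using (Σ; ∃; _×_; _,_; proj₁; proj₂)
open import Data.Sum using (_⊎_)
open import Data.Bool using (if_then_else_)
open import Data.List using (List; []; _∷_; length; concat; tabulate; lookup; allFin; map)
open import Data.Nat.ListAction using (sum)
open import Data.List.Membership.Propositional using (_∈_)
open import Data.List.Relation.Unary.All using (All)
open import Data.List.Relation.Unary.AllPairs using (AllPairs)
open import Data.List.Relation.Unary.Unique.Propositional using (Unique)
open import Relation.Binary.PropositionalEquality using (_≡_; _≢_)
open import Relation.Nullary using (¬_)

-- A (finite, undirected) graph: V vertices Fin V, edges given as a list of
-- (unordered) pairs; the orientation of a pair is irrelevant (see Adj).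
record Graph : Set where
  constructor graph
  field
    V : ℕ
    E : List (Fin V × Fin V)
open Graph public

module _ (G : Graph) where

  Adj : Fin (V G) → Fin (V G) → Set
  Adj u v = ((u , v) ∈ E G) ⊎ ((v , u) ∈ E G)

  data Walk : Fin (V G) → Fin (V G) → ℕ → Set where
    here : ∀ {u} → Walk u u 0
    step : ∀ {u w v k} → Adj u w → Walk w v k → Walk u v (suc k)

  verts : ∀ {u v k} → Walk u v k → List (Fin (V G))
  verts {u} here = u ∷ []
  verts {u} (step _ w) = u ∷ verts w

  Path : Fin (V G) → Fin (V G) → ℕ → Set
  Path u v k = Σ (Walk u v k) (λ w → Unique (verts w))

  Simple : Set
  Simple = All (λ e → proj₁ e ≢ proj₂ e) (E G)
         × AllPairs (λ e f → e ≢ f × e ≢ (proj₂ f , proj₁ f)) (E G)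

  Connected : Set
  Connected = ∀ u v → ∃ λ k → Walk u v k

  Acyclic : Set
  Acyclic = ∀ u v k → Path u v k → 2 ≤ k → ¬ Adj v u

  IsTree : Set
  IsTree = Simple × Connected × Acyclic

  pairSum : (Fin (V G) → Fin (V G) → ℕ) → ℕ
  pairSum f = sum (map (λ u → sum (map (λ v → if toℕ u <ᵇ toℕ v then f u v else 0)
                                       (allFin (V G))))
                       (allFin (V G)))

  -- S is the geodesic distance sum: d u v is the length of the (unique, in a
  -- tree) path joining u and v, and S is the sum over unordered pairs.
  DistanceSum : ℕ → Set
  DistanceSum S = Σ (Fin (V G) → Fin (V G) → ℕ)
                    (λ d → (∀ u v → Path u v (d u v)) × S ≡ pairSum d)

-- first-order subdivision: edge number k, (u , v), is replaced by the two
-- edges (u , w_k) and (w_k , v) with a new vertex w_k = n + k.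
subdivide : Graph → Graph
subdivide (graph n es) =
  graph (n + length es)
        (concat (tabulate (λ k →
           (proj₁ (lookup es k) ↑ˡ length es , n ↑ʳ k)
           ∷ (n ↑ʳ k , proj₂ (lookup es k) ↑ˡ length es)
           ∷ [])))

subdivideTimes : ℕ → Graph → Graph
subdivideTimes zero G = G
subdivideTimes (suc t) G = subdivide (subdivideTimes t G)

module Submission where

-- Fix a root v of a tree. Along every edge the distance from v changes by exactly one, and every
-- vertex other than v is the far endpoint of exactly one edge (the one towards v); hence the
-- edges {a,b} satisfy  Σ (d(v,a) + d(v,b)) = 2 D(v) - m,  where D(v) is the distance sum from v
-- and m = n - 1 the number of edges. In the subdivision, distances between original vertices
-- double, the midpoint w of an edge {a,b} lies halfway between a and b as seen from any other
-- vertex, and so d(x,w) = d(x,a) + d(x,b) for original x. Summing these relations over all pairs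
-- gives  S' = 8 S - 2 m (m + 1)  with 2m edges in the subdivision, which is again a tree;
-- solving this recurrence over t subdivisions gives the closed form.

open import Defs

-- ℕ arithmetic is opened only inside this block, so that the statement at the end can use the
-- operators of ℚ.
module _ where
  open import Data.Bool using (true; false; if_then_else_)
  open import Data.Empty using (⊥; ⊥-elim)
  open import Data.Fin using (Fin; zero; suc; toℕ; _↑ˡ_; _↑ʳ_; splitAt; _≟_)
  open import Data.Fin.Permutation using (Permutation; permutation; ↔⇒≡)
  open import Data.Fin.Properties
    using (splitAt-↑ˡ; splitAt-↑ʳ; splitAt⁻¹-↑ˡ; splitAt⁻¹-↑ʳ; ↑ˡ-injective; ↑ʳ-injective; toℕ-injective)
    renaming (suc-injective to fin-suc-injective)
  open import Data.List using (List; []; _∷_; _++_; [_]; length; lookup; concat; tabulate; map; allFin; reverse)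
  open import Data.List.Properties using (map-tabulate; unfold-reverse)
  open import Data.List.Membership.Propositional using (_∈_; _∉_)
  open import Data.List.Membership.Propositional.Properties
    using (∈-lookup; ∈-concat⁻′; ∈-concat⁺′; ∈-tabulate⁻; ∈-tabulate⁺)
  import Data.List.Membership.DecPropositional as DecMembership
  open import Data.List.Relation.Binary.Permutation.Setoid using (↭-sym)
  open import Data.List.Relation.Binary.Permutation.Setoid.Properties using (Unique-resp-↭; ↭-reverse)
  open import Data.List.Relation.Binary.Subset.Propositional using (_⊆_)
  open import Data.List.Relation.Unary.All using ([]; _∷_)
  import Data.List.Relation.Unary.All as All
  import Data.List.Relation.Unary.All.Properties as All
  open import Data.List.Relation.Unary.All.Properties using (¬Any⇒All¬; All¬⇒¬Any)
  open import Data.List.Relation.Unary.AllPairs using ([]; _∷_)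
  import Data.List.Relation.Unary.AllPairs as AllPairs
  open AllPairs using (AllPairs)
  import Data.List.Relation.Unary.AllPairs.Properties as AllPairs
  open import Data.List.Relation.Unary.Any using (here; there; index)
  open import Data.List.Relation.Unary.Any.Properties using (reverse⁻; lookup-index)
  open import Data.List.Relation.Unary.Unique.Propositional using (Unique)
  open import Data.List.Relation.Unary.Unique.Propositional.Properties using (Unique[x∷xs]⇒x∉xs)
  open import Data.Nat using (ℕ; zero; suc; _+_; _*_; _∸_; _^_; _≤_; _<_; z≤n; s≤s; _<ᵇ_)
  open import Data.Nat.ListAction using (sum)
  import Data.Nat.Properties as ℕ
  open import Algebra.Properties.Semiring.Sum ℕ.+-*-semiring
    using (sum-syntax; ∑-distrib-+; ∑-comm; ∑-permute; sum-cong-≗)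
    renaming (sum to ∑)
  open import Data.Nat.Tactic.RingSolver using (solve-∀)
  open import Data.Product using (Σ; ∃; ∃₂; _×_; _,_; proj₁; proj₂)
  open import Data.Sum using (_⊎_; inj₁; inj₂; map₁)
  open import Function using (_∘_)
  open import Relation.Binary.Definitions using (tri<; tri≈; tri>)
  open import Relation.Binary.PropositionalEquality hiding ([_])
  open import Relation.Binary.PropositionalEquality.Properties using (setoid)
  open import Relation.Nullary using (¬_; yes; no; ofʸ; ofⁿ)

  ∑-const : ∀ n c → ∑[ i < n ] c ≡ n * c
  ∑-const zero    c = refl
  ∑-const (suc n) c = cong (c +_) (∑-const n c)

  ∑-*ˡ : ∀ n c (f : Fin n → ℕ) → ∑[ i < n ] (c * f i) ≡ c * ∑[ i < n ] f i
  ∑-*ˡ zero    c f = sym (ℕ.*-zeroʳ c)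
  ∑-*ˡ (suc n) c f =
    trans (cong (c * f zero +_) (∑-*ˡ n c (λ i → f (suc i)))) (sym (ℕ.*-distribˡ-+ c (f zero) _))

  ∑-↑ : ∀ n m (f : Fin (n + m) → ℕ) →
        ∑[ i < n + m ] f i ≡ ∑[ i < n ] f (i ↑ˡ m) + ∑[ k < m ] f (n ↑ʳ k)
  ∑-↑ zero    m f = refl
  ∑-↑ (suc n) m f = trans (cong (f zero +_) (∑-↑ n m (λ i → f (suc i)))) (sym (ℕ.+-assoc (f zero) _ _))

  ∑-≗-except : ∀ {n} (f g : Fin n → ℕ) (l : Fin n) c →
               (∀ k → k ≢ l → f k ≡ g k) → f l ≡ g l + c → ∑ f ≡ ∑ g + c
  ∑-≗-except {suc n} f g zero c f≗g fl =
    trans (cong₂ _+_ fl (sum-cong-≗ (λ k → f≗g (suc k) (λ ())))) (swap (g zero) c _)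
    where
    swap : ∀ a c b → a + c + b ≡ a + b + c
    swap = solve-∀
  ∑-≗-except {suc n} f g (suc l) c f≗g fl =
    trans (cong₂ _+_ (f≗g zero (λ ())) (∑-≗-except (λ k → f (suc k)) (λ k → g (suc k)) l c
                                         (λ k k≢l → f≗g (suc k) (λ e → k≢l (fin-suc-injective e))) fl))
          (sym (ℕ.+-assoc (g zero) _ c))

  module _ {A : Set} where

    ∷-unique : ∀ {x : A} {xs} → x ∉ xs → Unique xs → Unique (x ∷ xs)
    ∷-unique {xs = xs} x∉xs xs! = ¬Any⇒All¬ xs x∉xs ∷ xs!

    reverse-unique : ∀ {xs : List A} → Unique xs → Unique (reverse xs)
    reverse-unique {xs} = Unique-resp-↭ (setoid A) (↭-sym (setoid A) (↭-reverse (setoid A) xs))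

    AllPairs-lookup : ∀ {R : A → A → Set} {xs : List A} → AllPairs R xs → ∀ i j → i ≢ j →
                      R (lookup xs i) (lookup xs j) ⊎ R (lookup xs j) (lookup xs i)
    AllPairs-lookup (_  ∷ _)   zero    zero    i≢j = ⊥-elim (i≢j refl)
    AllPairs-lookup (Rx ∷ _)   zero    (suc j) _   = inj₁ (All.lookup Rx (∈-lookup j))
    AllPairs-lookup (Rx ∷ _)   (suc i) zero    _   = inj₂ (All.lookup Rx (∈-lookup i))
    AllPairs-lookup (_  ∷ Rxs) (suc i) (suc j) i≢j = AllPairs-lookup Rxs i j (λ i≡j → i≢j (cong suc i≡j))

  adj-sym : ∀ G {u v} → Adj G u v → Adj G v u
  adj-sym G (inj₁ e) = inj₂ e
  adj-sym G (inj₂ e) = inj₁ e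

  module _ {G : Graph} where

    infixr 5 _++ʷ_

    _++ʷ_ : ∀ {u v w k j} → Walk G u v k → Walk G v w j → Walk G u w (k + j)
    here     ++ʷ q = q
    step a p ++ʷ q = step a (p ++ʷ q)

    ∈-++ʷ : ∀ {u v w k j x} (p : Walk G u v k) (q : Walk G v w j) →
            x ∈ verts G (p ++ʷ q) → x ∈ verts G p ⊎ x ∈ verts G q
    ∈-++ʷ here       q x∈       = inj₂ x∈
    ∈-++ʷ (step a p) q (here e) = inj₁ (here e)
    ∈-++ʷ (step a p) q (there x∈) = map₁ there (∈-++ʷ p q x∈)

    start∈verts : ∀ {u v k} (p : Walk G u v k) → u ∈ verts G p
    start∈verts here       = here refl
    start∈verts (step _ _) = here refl

    end∈verts : ∀ {u v k} (p : Walk G u v k) → v ∈ verts G p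
    end∈verts here       = here refl
    end∈verts (step _ p) = there (end∈verts p)

    verts-subst : ∀ {u v k j} (e : k ≡ j) (p : Walk G u v k) → verts G (subst (Walk G u v) e p) ≡ verts G p
    verts-subst refl p = refl

    reverseʷ : ∀ {u v k} → Walk G u v k → Walk G v u k
    reverseʷ here                 = here
    reverseʷ (step {k = k} a p) = subst (Walk G _ _) (ℕ.+-comm k 1) (reverseʷ p ++ʷ step (adj-sym G a) here)

    verts-reverseʷ : ∀ {u v k} (p : Walk G u v k) → verts G (reverseʷ p) ≡ reverse (verts G p)
    verts-reverseʷ here = refl
    verts-reverseʷ {u} (step {k = k} a p) = begin
      verts G (subst (Walk G _ _) (ℕ.+-comm k 1) (reverseʷ p ++ʷ last))  ≡⟨ verts-subst (ℕ.+-comm k 1) _ ⟩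
      verts G (reverseʷ p ++ʷ last)                                      ≡⟨ verts-++ʷ-last (reverseʷ p) ⟩
      verts G (reverseʷ p) ++ [ u ]                                      ≡⟨ cong (_++ [ u ]) (verts-reverseʷ p) ⟩
      reverse (verts G p) ++ [ u ]                                       ≡⟨ unfold-reverse u (verts G p) ⟨
      reverse (u ∷ verts G p)                                            ∎
      where
      open ≡-Reasoning
      last = step (adj-sym G a) here
      verts-++ʷ-last : ∀ {x i} (q : Walk G x _ i) → verts G (q ++ʷ last) ≡ verts G q ++ [ u ]
      verts-++ʷ-last here       = refl
      verts-++ʷ-last (step b q) = cong (_ ∷_) (verts-++ʷ-last q)

    ∈-reverseʷ⁻ : ∀ {u v k x} (p : Walk G u v k) → x ∈ verts G (reverseʷ p) → x ∈ verts G p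
    ∈-reverseʷ⁻ p x∈ = reverse⁻ (subst (_ ∈_) (verts-reverseʷ p) x∈)

    path-ends-distinct : ∀ {u v k} → Path G u v (suc k) → u ≢ v
    path-ends-distinct (step _ p , up!) refl = Unique[x∷xs]⇒x∉xs up! (end∈verts p)

    reversePath : ∀ {u v k} → Path G u v k → Path G v u k
    reversePath (p , p!) = reverseʷ p , subst Unique (sym (verts-reverseʷ p)) (reverse-unique p!)

    record Suffix {u v k} (p : Walk G u v k) (x : Fin (V G)) : Set where
      constructor suffix
      field
        {len}  : ℕ
        walk   : Walk G x v len
        ⊆verts : verts G walk ⊆ verts G p
        unique : Unique (verts G p) → Unique (verts G walk)

    suffixAt : ∀ {u v k x} (p : Walk G u v k) → x ∈ verts G p → Suffix p x
    suffixAt here       (here refl) = suffix here (λ y∈ → y∈) (λ p! → p!)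
    suffixAt (step a p) (here refl) = suffix (step a p) (λ y∈ → y∈) (λ p! → p!)
    suffixAt (step a p) (there x∈)  with suffixAt p x∈
    ... | suffix q q⊆p q! = suffix q (λ y∈ → there (q⊆p y∈)) (λ { (_ ∷ p!) → q! p! })

    record Prefix {u v k} (p : Walk G u v k) (x : Fin (V G)) : Set where
      constructor prefix
      field
        {len}  : ℕ
        walk   : Walk G u x len
        ⊆verts : verts G walk ⊆ verts G p
        unique : Unique (verts G p) → Unique (verts G walk)
        proper : len < k ⊎ x ≡ v

    prefixAt : ∀ {u v k x} (p : Walk G u v k) → x ∈ verts G p → Prefix p x
    prefixAt here       (here refl) = prefix here (λ y∈ → y∈) (λ p! → p!) (inj₂ refl)
    prefixAt (step a p) (here refl) = prefix here (λ { (here e) → here e }) (λ _ → [] ∷ []) (inj₁ (s≤s z≤n))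
    prefixAt (step a p) (there x∈)  with prefixAt p x∈
    ... | prefix q q⊆p q! q< =
      prefix (step a q) (λ { (here e) → here e ; (there y∈) → there (q⊆p y∈) })
             (λ { (u∉ ∷ p!) → ∷-unique (λ u∈q → All¬⇒¬Any u∉ (q⊆p u∈q)) (q! p!) })
             (map₁ s≤s q<)

    open DecMembership (_≟_ {n = V G}) using (_∈?_)

    walk⇒path : ∀ {u v k} (p : Walk G u v k) → ∃₂ λ j (q : Path G u v j) → verts G (proj₁ q) ⊆ verts G p
    walk⇒path here = 0 , (here , [] ∷ []) , λ x∈ → x∈
    walk⇒path {u} (step a p) with walk⇒path p
    ... | j , (q , q!) , q⊆p with u ∈? verts G q
    ...   | yes u∈q = let suffix r r⊆q r! = suffixAt q u∈q in _ , (r , r! q!) , λ x∈ → there (q⊆p (r⊆q x∈))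
    ...   | no  u∉q = suc j , (step a q , ∷-unique u∉q q!) , λ { (here e) → here e ; (there x∈) → there (q⊆p x∈) }

  neighbours-sum : ∀ {a b c} → a ≡ suc b → c ≡ suc a → b + c ≡ 2 * a
  neighbours-sum {b = b} refl refl = lemma b
    where
    lemma : ∀ b → b + suc (suc b) ≡ 2 * suc b
    lemma = solve-∀

  successor-sum : ∀ {x y} → y ≡ suc x → x + y + 1 ≡ 2 * y
  successor-sum {x} refl = lemma x
    where
    lemma : ∀ x → x + suc x + 1 ≡ 2 * suc x
    lemma = solve-∀

  no-mutual-successors : ∀ {p q : ℕ} → p ≡ suc q → q ≡ suc p → ⊥
  no-mutual-successors {q = q} refl q≡2+q = ℕ.m≢1+n+m q {1} q≡2+q

  module Tree {G : Graph} (tree : IsTree G) where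

    open DecMembership (_≟_ {n = V G}) using (_∈?_)

    private
      simple  = proj₁ tree
      acyclic = proj₂ (proj₂ tree)

    adjacent⇒distinct : ∀ {a b} → Adj G a b → a ≢ b
    adjacent⇒distinct (inj₁ ab∈) a≡b = All.lookup (proj₁ simple) ab∈ a≡b
    adjacent⇒distinct (inj₂ ba∈) a≡b = All.lookup (proj₁ simple) ba∈ (sym a≡b)

    -- Gluing the two branches and erasing loops gives a path x ⋯ y avoiding u, closed up by y u x into a cycle.
    branches-meet⇒⊥ : ∀ {u x y v k k′} → Adj G u x → (p : Walk G x v k) → Adj G u y → (q : Walk G y v k′) →
                      Unique (u ∷ verts G p) → Unique (u ∷ verts G q) → x ≢ y → ⊥
    branches-meet⇒⊥ {u} ux p uy q up! uq! x≢y with walk⇒path (p ++ʷ reverseʷ q)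
    ... | zero  , (here , _)   , _   = x≢y refl
    ... | suc j , (r , r!) , r⊆ =
      acyclic u _ (suc (suc j)) (step ux r , ∷-unique u∉r r!) (s≤s (s≤s z≤n)) (adj-sym G uy)
      where
      u∉r : u ∉ verts G r
      u∉r u∈r with ∈-++ʷ p (reverseʷ q) (r⊆ u∈r)
      ... | inj₁ u∈p = Unique[x∷xs]⇒x∉xs up! u∈p
      ... | inj₂ u∈q = Unique[x∷xs]⇒x∉xs uq! (∈-reverseʷ⁻ q u∈q)

    path-length-unique : ∀ {u v k k′} → Path G u v k → Path G u v k′ → k ≡ k′
    path-length-unique (here , _) (here , _) = refl
    path-length-unique (here , _) (step _ q , q!) = ⊥-elim (Unique[x∷xs]⇒x∉xs q! (end∈verts q))
    path-length-unique (step _ p , p!) (here , _) = ⊥-elim (Unique[x∷xs]⇒x∉xs p! (end∈verts p))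
    path-length-unique (step {w = x} ux p , p!) (step {w = y} uy q , q!) with x ≟ y
    ... | yes refl = cong suc (path-length-unique (p , AllPairs.tail p!) (q , AllPairs.tail q!))
    ... | no  x≢y  = ⊥-elim (branches-meet⇒⊥ ux p uy q p! q! x≢y)

    module Distance (d : Fin (V G) → Fin (V G) → ℕ) (d-path : ∀ u v → Path G u v (d u v)) where

      path⇒d : ∀ {u v k} → Path G u v k → k ≡ d u v
      path⇒d p = path-length-unique p (d-path _ _)

      d-diag : ∀ u → d u u ≡ 0
      d-diag u = sym (path⇒d (here , [] ∷ []))

      d-sym : ∀ u v → d u v ≡ d v u
      d-sym u v = path⇒d (reversePath (d-path u v))

      private
        geodesic : ∀ v a → Walk G v a (d v a)
        geodesic v a = proj₁ (d-path v a)

        prefix⇒< : ∀ {v a x} (pre : Prefix (geodesic v a) x) → Prefix.len pre < d v a → d v x < d v a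
        prefix⇒< {v} {a} pre = subst (_< d v a) (path⇒d (Prefix.walk pre , Prefix.unique pre (proj₂ (d-path v a))))

      farther∉geodesic : ∀ {v a x} → d v a < d v x → x ∉ verts G (geodesic v a)
      farther∉geodesic a<x x∈ with prefixAt _ x∈
      ... | pre@(prefix _ _ _ (inj₁ len<)) = ℕ.<-asym a<x (prefix⇒< pre len<)
      ... | prefix _ _ _ (inj₂ refl)       = ℕ.n≮n _ a<x

      extend-geodesic : ∀ {v a b} → Adj G b a → b ∉ verts G (geodesic v a) → d v b ≡ suc (d v a)
      extend-geodesic {v} {a} {b} ba b∉ = trans (d-sym v b) (sym (path⇒d (step ba p , ∷-unique b∉p p!)))
        where
        p = proj₁ (reversePath (d-path v a))
        p! = proj₂ (reversePath (d-path v a))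
        b∉p : b ∉ verts G p
        b∉p b∈ = b∉ (∈-reverseʷ⁻ (geodesic v a) b∈)

      adjacent-distance : ∀ {a b} v → Adj G a b → d v b ≡ suc (d v a) ⊎ d v a ≡ suc (d v b)
      adjacent-distance {a} {b} v ab with b ∈? verts G (geodesic v a) | a ∈? verts G (geodesic v b)
      ... | no b∉    | _        = inj₁ (extend-geodesic (adj-sym G ab) b∉)
      ... | yes _    | no a∉    = inj₂ (extend-geodesic ab a∉)
      ... | yes b∈a  | yes a∈b  = ⊥-elim (both-closer (prefixAt _ b∈a) (prefixAt _ a∈b))
        where
        both-closer : Prefix (geodesic v a) b → Prefix (geodesic v b) a → ⊥
        both-closer _ (prefix _ _ _ (inj₂ a≡b)) = adjacent⇒distinct ab a≡b
        both-closer (prefix _ _ _ (inj₂ b≡a)) _ = adjacent⇒distinct ab (sym b≡a)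
        both-closer pb@(prefix _ _ _ (inj₁ i<)) pa@(prefix _ _ _ (inj₁ j<)) =
          ℕ.<-asym (prefix⇒< pb i<) (prefix⇒< pa j<)

      closer-neighbour : ∀ {v x} → x ≢ v → ∃ λ y → Adj G x y × d v x ≡ suc (d v y)
      closer-neighbour {v} {x} x≢v = first-step (reversePath (d-path v x))
        where
        first-step : ∀ {k} → Path G x v k → ∃ λ y → Adj G x y × k ≡ suc (d v y)
        first-step (here , _)        = ⊥-elim (x≢v refl)
        first-step (step xy p , xp!) = _ , xy , cong suc (trans (path⇒d (p , AllPairs.tail xp!)) (d-sym _ _))

      closer-neighbour-unique : ∀ {v x a b} → Adj G x a → Adj G x b →
                                d v x ≡ suc (d v a) → d v x ≡ suc (d v b) → a ≡ b
      closer-neighbour-unique {v} {x} {a} {b} xa xb x>a x>b with a ≟ b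
      ... | yes a≡b = a≡b
      ... | no  a≢b = ⊥-elim (branches-meet⇒⊥ xa (reverseʷ (geodesic v a)) xb (reverseʷ (geodesic v b))
                                               (x∷geodesic x>a) (x∷geodesic x>b) a≢b)
        where
        x∷geodesic : ∀ {c} → d v x ≡ suc (d v c) → Unique (x ∷ verts G (reverseʷ (geodesic v c)))
        x∷geodesic {c} x>c = ∷-unique (λ x∈ → farther∉geodesic (subst (d v c <_) (sym x>c) ℕ.≤-refl) (∈-reverseʷ⁻ _ x∈))
                                      (proj₂ (reversePath (d-path v c)))

      farther-neighbour : ∀ {v x y z} → Adj G x y → Adj G x z → d v x ≡ suc (d v y) → y ≢ z →
                          d v z ≡ suc (d v x)
      farther-neighbour {v} xy xz x>y y≢z with adjacent-distance v xz
      ... | inj₁ z>x = z>x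
      ... | inj₂ x>z = ⊥-elim (y≢z (closer-neighbour-unique xy xz x>y x>z))

      midpoint : ∀ {v x y z} → x ≢ v → Adj G x y → Adj G x z → y ≢ z →
                 (∀ w → Adj G x w → w ≡ y ⊎ w ≡ z) → d v y + d v z ≡ 2 * d v x
      midpoint {v} {x} {y} {z} x≢v xy xz y≢z only-y-z with closer-neighbour x≢v
      ... | w , xw , x>w with only-y-z w xw
      ...   | inj₁ refl = neighbours-sum x>w (farther-neighbour xy xz x>w y≢z)
      ...   | inj₂ refl = trans (ℕ.+-comm (d v y) (d v z))
                                (neighbours-sum x>w (farther-neighbour xz xy x>w (λ z≡y → y≢z (sym z≡y))))

  module Edges {G : Graph} (tree : IsTree G) where

    open Tree tree

    m : ℕ
    m = length (E G)

    a b : Fin m → Fin (V G)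
    a k = proj₁ (lookup (E G) k)
    b k = proj₂ (lookup (E G) k)

    edge-adj : ∀ k → Adj G (a k) (b k)
    edge-adj k = inj₁ (∈-lookup k)

    Joins : Fin m → Fin (V G) → Fin (V G) → Set
    Joins k p q = lookup (E G) k ≡ (p , q) ⊎ lookup (E G) k ≡ (q , p)

    joins-sym : ∀ {k p q} → Joins k p q → Joins k q p
    joins-sym (inj₁ e) = inj₂ e
    joins-sym (inj₂ e) = inj₁ e

    joins-endpoints : ∀ {k p q p′ q′} → Joins k p q → Joins k p′ q′ → (p ≡ p′ × q ≡ q′) ⊎ (p ≡ q′ × q ≡ p′)
    joins-endpoints (inj₁ e) (inj₁ e′) with trans (sym e) e′
    ... | refl = inj₁ (refl , refl)
    joins-endpoints (inj₁ e) (inj₂ e′) with trans (sym e) e′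
    ... | refl = inj₂ (refl , refl)
    joins-endpoints (inj₂ e) (inj₁ e′) with trans (sym e) e′
    ... | refl = inj₂ (refl , refl)
    joins-endpoints (inj₂ e) (inj₂ e′) with trans (sym e) e′
    ... | refl = inj₁ (refl , refl)

    private
      distinct-pairs-join-different : ∀ {e f : Fin (V G) × Fin (V G)} {p q} →
        (e ≡ (p , q) ⊎ e ≡ (q , p)) → (f ≡ (p , q) ⊎ f ≡ (q , p)) → e ≢ f × e ≢ (proj₂ f , proj₁ f) → ⊥
      distinct-pairs-join-different (inj₁ refl) (inj₁ refl) (≢f , _)  = ≢f refl
      distinct-pairs-join-different (inj₁ refl) (inj₂ refl) (_ , ≢f′) = ≢f′ refl
      distinct-pairs-join-different (inj₂ refl) (inj₁ refl) (_ , ≢f′) = ≢f′ refl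
      distinct-pairs-join-different (inj₂ refl) (inj₂ refl) (≢f , _)  = ≢f refl

    joins-unique : ∀ {k l p q} → Joins k p q → Joins l p q → k ≡ l
    joins-unique {k} {l} jk jl with k ≟ l
    ... | yes k≡l = k≡l
    ... | no  k≢l with AllPairs-lookup (proj₂ (proj₁ tree)) k l k≢l
    ...   | inj₁ k≉l = ⊥-elim (distinct-pairs-join-different jk jl k≉l)
    ...   | inj₂ l≉k = ⊥-elim (distinct-pairs-join-different jl jk l≉k)

    adj⇒joins : ∀ {x y} → Adj G x y → ∃ λ k → Joins k x y
    adj⇒joins (inj₁ xy∈) = index xy∈ , inj₁ (sym (lookup-index xy∈))
    adj⇒joins (inj₂ yx∈) = index yx∈ , inj₂ (sym (lookup-index yx∈))

    module Rooted (d : Fin (V G) → Fin (V G) → ℕ) (d-path : ∀ u v → Path G u v (d u v)) (v : Fin (V G)) where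

      open Distance d d-path

      record Oriented (k : Fin m) : Set where
        constructor oriented
        field
          near far : Fin (V G)
          far-adj  : Adj G far near
          far>near : d v far ≡ suc (d v near)
          joins    : Joins k near far

      orient : ∀ k → Oriented k
      orient k with adjacent-distance v (edge-adj k)
      ... | inj₁ b>a = oriented (a k) (b k) (adj-sym G (edge-adj k)) b>a (inj₁ refl)
      ... | inj₂ a>b = oriented (b k) (a k) (edge-adj k) a>b (inj₂ refl)

      far : Fin m → Fin (V G)
      far k = Oriented.far (orient k)

      endpoints-sum : ∀ k → d v (a k) + d v (b k) + 1 ≡ 2 * d v (far k)
      endpoints-sum k with adjacent-distance v (edge-adj k)
      ... | inj₁ b>a = successor-sum b>a
      ... | inj₂ a>b = trans (cong (_+ 1) (ℕ.+-comm (d v (a k)) (d v (b k)))) (successor-sum a>b)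

      far≢root : ∀ k → far k ≢ v
      far≢root k far≡v = ℕ.0≢1+n (trans (sym (d-diag v)) (trans (cong (d v) (sym far≡v)) (Oriented.far>near (orient k))))

      parent-edge : ∀ {x} → x ≢ v → Fin m
      parent-edge x≢v = proj₁ (adj⇒joins (proj₁ (proj₂ (closer-neighbour x≢v))))

      far-parent-edge : ∀ {x} (x≢v : x ≢ v) → far (parent-edge x≢v) ≡ x
      far-parent-edge x≢v with closer-neighbour x≢v
      ... | y , xy , x>y with adj⇒joins xy
      ...   | k , joins-xy with joins-endpoints joins-xy (Oriented.joins (orient k))
      ...     | inj₁ (refl , refl) = ⊥-elim (no-mutual-successors x>y (Oriented.far>near (orient k)))
      ...     | inj₂ (x≡far , _)   = sym x≡far

      parent-edge-far : ∀ k (far≢v : far k ≢ v) → parent-edge far≢v ≡ k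
      parent-edge-far k far≢v with closer-neighbour far≢v
      ... | y , xy , x>y = joins-unique (proj₂ (adj⇒joins xy)) (joins-sym (subst (λ z → Joins k z (far k)) y≡near′ (Oriented.joins o)))
        where
        o = orient k
        y≡near′ : Oriented.near o ≡ y
        y≡near′ = closer-neighbour-unique (Oriented.far-adj o) xy (Oriented.far>near o) x>y

      far-endpoints : Permutation (suc m) (V G)
      far-endpoints = permutation root-or-far root-or-parent-edge inverseˡ inverseʳ
        where
        root-or-far : Fin (suc m) → Fin (V G)
        root-or-far zero    = v
        root-or-far (suc k) = far k

        root-or-parent-edge : Fin (V G) → Fin (suc m)
        root-or-parent-edge x with x ≟ v
        ... | yes _   = zero
        ... | no  x≢v = suc (parent-edge x≢v)

        inverseˡ : ∀ x → root-or-far (root-or-parent-edge x) ≡ x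
        inverseˡ x with x ≟ v
        ... | yes x≡v = sym x≡v
        ... | no  x≢v = far-parent-edge x≢v

        inverseʳ : ∀ i → root-or-parent-edge (root-or-far i) ≡ i
        inverseʳ zero with v ≟ v
        ... | yes _   = refl
        ... | no  v≢v = ⊥-elim (v≢v refl)
        inverseʳ (suc k) with far k ≟ v
        ... | yes far≡v = ⊥-elim (far≢root k far≡v)
        ... | no  far≢v = cong suc (parent-edge-far k far≢v)

      ∑-vertices-via-edges : (f : Fin (V G) → ℕ) → ∑ f ≡ f v + ∑[ k < m ] f (far k)
      ∑-vertices-via-edges f = ∑-permute f far-endpoints

      edge-count : suc m ≡ V G
      edge-count = ↔⇒≡ far-endpoints

      ∑-endpoint-distances : ∑[ k < m ] (d v (a k) + d v (b k)) + m ≡ 2 * ∑[ x < V G ] d v x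
      ∑-endpoint-distances = begin
        ∑[ k < m ] ends k + m                 ≡⟨ cong (∑[ k < m ] ends k +_) (trans (∑-const m 1) (ℕ.*-identityʳ m)) ⟨
        ∑[ k < m ] ends k + ∑[ k < m ] 1      ≡⟨ ∑-distrib-+ ends (λ _ → 1) ⟨
        ∑[ k < m ] (ends k + 1)               ≡⟨ sum-cong-≗ endpoints-sum ⟩
        ∑[ k < m ] (2 * d v (far k))          ≡⟨ ∑-*ˡ m 2 (λ k → d v (far k)) ⟩
        2 * ∑[ k < m ] d v (far k)            ≡⟨ cong (λ z → 2 * (z + ∑[ k < m ] d v (far k))) (d-diag v) ⟨
        2 * (d v v + ∑[ k < m ] d v (far k))  ≡⟨ cong (2 *_) (∑-vertices-via-edges (d v)) ⟨
        2 * ∑[ x < V G ] d v x                ∎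
        where
        open ≡-Reasoning
        ends : Fin m → ℕ
        ends k = d v (a k) + d v (b k)

  module Subdivision {G : Graph} (tree : IsTree G) where

    open Tree tree using (adjacent⇒distinct)
    open Edges tree using (m; a; b; edge-adj; Joins; joins-unique; adj⇒joins)

    private
      n = V G
      S = subdivide G
      acyclic = proj₂ (proj₂ tree)

    orig : Fin n → Fin (n + m)
    orig i = i ↑ˡ m

    mid : Fin m → Fin (n + m)
    mid k = n ↑ʳ k

    orig≢mid : ∀ {i k} → orig i ≢ mid k
    orig≢mid {i} {k} eq with trans (sym (splitAt-↑ˡ n i m)) (trans (cong (splitAt n) eq) (splitAt-↑ʳ n m k))
    ... | ()

    orig-injective : ∀ {i j} → orig i ≡ orig j → i ≡ j
    orig-injective = ↑ˡ-injective m _ _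

    mid-injective : ∀ {k l} → mid k ≡ mid l → k ≡ l
    mid-injective = ↑ʳ-injective n _ _

    Endpoint : Fin m → Fin n → Set
    Endpoint k c = c ≡ a k ⊎ c ≡ b k

    endpoints-adj : ∀ {k p q} → Endpoint k p → Endpoint k q → p ≢ q → Adj G p q
    endpoints-adj {k} (inj₁ refl) (inj₁ refl) p≢q = ⊥-elim (p≢q refl)
    endpoints-adj {k} (inj₁ refl) (inj₂ refl) _   = edge-adj k
    endpoints-adj {k} (inj₂ refl) (inj₁ refl) _   = adj-sym G (edge-adj k)
    endpoints-adj {k} (inj₂ refl) (inj₂ refl) p≢q = ⊥-elim (p≢q refl)

    endpoints-join : ∀ {k p q} → Endpoint k p → Endpoint k q → p ≢ q → Joins k p q
    endpoints-join (inj₁ refl) (inj₁ refl) p≢q = ⊥-elim (p≢q refl)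
    endpoints-join (inj₁ refl) (inj₂ refl) _   = inj₁ refl
    endpoints-join (inj₂ refl) (inj₁ refl) _   = inj₂ refl
    endpoints-join (inj₂ refl) (inj₂ refl) p≢q = ⊥-elim (p≢q refl)

    join⇒endpoints : ∀ {k p q} → Joins k p q → Endpoint k p × Endpoint k q
    join⇒endpoints (inj₁ e) = inj₁ (cong proj₁ (sym e)) , inj₂ (cong proj₂ (sym e))
    join⇒endpoints (inj₂ e) = inj₂ (cong proj₂ (sym e)) , inj₁ (cong proj₁ (sym e))

    halves : Fin m → List (Fin (n + m) × Fin (n + m))
    halves k = (orig (a k) , mid k) ∷ (mid k , orig (b k)) ∷ []

    HalfOf : Fin m → Fin (n + m) × Fin (n + m) → Set
    HalfOf k e = ∃ λ c → Endpoint k c × (e ≡ (orig c , mid k) ⊎ e ≡ (mid k , orig c))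

    halves⇒HalfOf : ∀ {k e} → e ∈ halves k → HalfOf k e
    halves⇒HalfOf (here refl)         = _ , inj₁ refl , inj₁ refl
    halves⇒HalfOf (there (here refl)) = _ , inj₂ refl , inj₂ refl

    subdivision-edge : ∀ {e} → e ∈ E S → ∃ λ k → HalfOf k e
    subdivision-edge e∈ with ∈-concat⁻′ (tabulate halves) e∈
    ... | _ , e∈halves , halves∈ with ∈-tabulate⁻ halves∈
    ...   | k , refl = k , halves⇒HalfOf e∈halves

    orig-adj-mid : ∀ {k c} → Endpoint k c → Adj S (orig c) (mid k)
    orig-adj-mid {k} (inj₁ refl) = inj₁ (∈-concat⁺′ (here refl) (∈-tabulate⁺ k))
    orig-adj-mid {k} (inj₂ refl) = inj₂ (∈-concat⁺′ (there (here refl)) (∈-tabulate⁺ k))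

    mid-adj-orig : ∀ {k c} → Endpoint k c → Adj S (mid k) (orig c)
    mid-adj-orig c∈k = adj-sym S (orig-adj-mid c∈k)

    subdivision-adj : ∀ {x y} → Adj S x y →
      ∃₂ λ k c → Endpoint k c × ((x ≡ orig c × y ≡ mid k) ⊎ (x ≡ mid k × y ≡ orig c))
    subdivision-adj (inj₁ xy∈) with subdivision-edge xy∈
    ... | k , c , c∈k , inj₁ refl = k , c , c∈k , inj₁ (refl , refl)
    ... | k , c , c∈k , inj₂ refl = k , c , c∈k , inj₂ (refl , refl)
    subdivision-adj (inj₂ yx∈) with subdivision-edge yx∈
    ... | k , c , c∈k , inj₁ refl = k , c , c∈k , inj₂ (refl , refl)
    ... | k , c , c∈k , inj₂ refl = k , c , c∈k , inj₁ (refl , refl)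

    mid-neighbour : ∀ {k z} → Adj S (mid k) z → ∃ λ c → Endpoint k c × z ≡ orig c
    mid-neighbour adj with subdivision-adj adj
    ... | _ , _ , _   , inj₁ (mid≡orig , _) = ⊥-elim (orig≢mid (sym mid≡orig))
    ... | _ , c , c∈k , inj₂ (mid≡mid , z≡orig) with mid-injective mid≡mid
    ...   | refl = c , c∈k , z≡orig

    orig-neighbour : ∀ {x z} → Adj S (orig x) z → ∃ λ k → Endpoint k x × z ≡ mid k
    orig-neighbour adj with subdivision-adj adj
    ... | _ , _ , _ , inj₂ (orig≡mid , _) = ⊥-elim (orig≢mid orig≡mid)
    ... | k , _ , c∈k , inj₁ (orig≡orig , z≡mid) with orig-injective orig≡orig
    ...   | refl = k , c∈k , z≡mid

    subdivision-simple : Simple S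
    subdivision-simple = All.tabulate no-loop , AllPairs.concat⁺ (All.tabulate⁺ within) (AllPairs.tabulate⁺ across)
      where
      Distinct : (e f : Fin (n + m) × Fin (n + m)) → Set
      Distinct e f = e ≢ f × e ≢ (proj₂ f , proj₁ f)

      no-loop : ∀ {e} → e ∈ E S → proj₁ e ≢ proj₂ e
      no-loop e∈ with subdivision-edge e∈
      ... | _ , _ , _ , inj₁ refl = orig≢mid
      ... | _ , _ , _ , inj₂ refl = λ mid≡orig → orig≢mid (sym mid≡orig)

      within : ∀ k → AllPairs Distinct (halves k)
      within k = (((λ e → orig≢mid (cong proj₁ e)) , (λ e → adjacent⇒distinct (edge-adj k) (orig-injective (cong proj₁ e))))
                  ∷ []) ∷ [] ∷ []

      halves-distinct : ∀ {k l e f} → HalfOf k e → HalfOf l f → k ≢ l → Distinct e f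
      halves-distinct (_ , _ , inj₁ refl) (_ , _ , inj₁ refl) k≢l = (λ e → k≢l (mid-injective (cong proj₂ e))) , (λ e → orig≢mid (cong proj₁ e))
      halves-distinct (_ , _ , inj₁ refl) (_ , _ , inj₂ refl) k≢l = (λ e → orig≢mid (cong proj₁ e)) , (λ e → k≢l (mid-injective (cong proj₂ e)))
      halves-distinct (_ , _ , inj₂ refl) (_ , _ , inj₁ refl) k≢l = (λ e → orig≢mid (sym (cong proj₁ e))) , (λ e → k≢l (mid-injective (cong proj₁ e)))
      halves-distinct (_ , _ , inj₂ refl) (_ , _ , inj₂ refl) k≢l = (λ e → k≢l (mid-injective (cong proj₁ e))) , (λ e → orig≢mid (sym (cong proj₁ e)))

      across : ∀ {k l} → k ≢ l → All.All (λ e → All.All (Distinct e) (halves l)) (halves k)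
      across k≢l = All.tabulate (λ e∈ → All.tabulate (λ f∈ → halves-distinct (halves⇒HalfOf e∈) (halves⇒HalfOf f∈) k≢l))

    subdivide-walk : ∀ {x y j} → Walk G x y j → ∃ λ j′ → Walk S (orig x) (orig y) j′
    subdivide-walk here = 0 , here
    subdivide-walk (step xy p) with join⇒endpoints (proj₂ (adj⇒joins xy))
    ... | x∈k , y∈k = _ , step (orig-adj-mid x∈k) (step (mid-adj-orig y∈k) (proj₂ (subdivide-walk p)))

    walk-to-orig : ∀ z → ∃₂ λ c j → Walk S z (orig c) j
    walk-to-orig z with splitAt n z in eq
    ... | inj₁ i = i , 0 , subst (λ z′ → Walk S z′ (orig i) 0) (splitAt⁻¹-↑ˡ eq) here
    ... | inj₂ k = a k , 1 , subst (λ z′ → Walk S z′ (orig (a k)) 1) (splitAt⁻¹-↑ʳ eq) (step (mid-adj-orig (inj₁ refl)) here)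

    subdivision-connected : Connected S
    subdivision-connected u v with walk-to-orig u | walk-to-orig v
    ... | c , _ , p | c′ , _ , q with proj₁ (proj₂ tree) c c′
    ...   | _ , r = _ , p ++ʷ proj₂ (subdivide-walk r) ++ʷ reverseʷ q

    -- Every path of the subdivision between original vertices alternates orig, mid, orig, …
    project : ∀ {s t k x y} (p : Walk S s t k) → s ≡ orig x → t ≡ orig y → Unique (verts S p) →
              ∃₂ λ j (q : Path G x y j) → (∀ {z} → z ∈ verts G (proj₁ q) → orig z ∈ verts S p) × k ≡ 2 * j
    project here refl t≡orig _ with orig-injective t≡orig
    ... | refl = 0 , (here , [] ∷ []) , (λ { (here refl) → here refl }) , refl
    project (step s-z here) refl refl _ with orig-neighbour s-z
    ... | _ , _ , orig≡mid = ⊥-elim (orig≢mid orig≡mid)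
    project {x = x} (step s-z (step z-z′ p)) refl t≡orig xzp! with orig-neighbour s-z
    ... | k , x∈k , refl with mid-neighbour z-z′
    ...   | c , c∈k , refl with project p refl t≡orig (AllPairs.tail (AllPairs.tail xzp!))
    ...     | j , (q , q!) , q⊆p , k′≡2j =
      suc j , (step (endpoints-adj x∈k c∈k x≢c) q , ∷-unique x∉q q!) ,
      (λ { (here refl) → here refl ; (there z∈) → there (there (q⊆p z∈)) }) ,
      trans (cong (2 +_) k′≡2j) (sym (ℕ.*-suc 2 j))
      where
      x∉q : x ∉ verts G q
      x∉q x∈q = Unique[x∷xs]⇒x∉xs xzp! (there (q⊆p x∈q))
      x≢c : x ≢ c
      x≢c refl = Unique[x∷xs]⇒x∉xs xzp! (there (start∈verts p))

    two-step-walk : ∀ {y c} (r : Walk S (orig y) (orig c) 2) →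
                    ∃ λ k → Endpoint k y × Endpoint k c × mid k ∈ verts S r
    two-step-walk (step y-z (step z-c here)) with orig-neighbour y-z
    ... | k , y∈k , refl with mid-neighbour z-c
    ...   | c′ , c′∈k , c≡c′ with orig-injective c≡c′
    ...     | refl = k , y∈k , c′∈k , there (here refl)

    -- A cycle must pass through some mid k, between the two endpoints y and c of k; the rest of it
    -- projects to a path y ⋯ c of G which is either the edge k itself (so mid k repeats) or closes a cycle of G.
    cycle-through-mid⇒⊥ : ∀ {k c t j} → Path S (mid k) t j → t ≡ orig c → 2 ≤ j → Endpoint k c → ⊥
    cycle-through-mid⇒⊥ {k} {c} (step k-z p , kp!) refl (s≤s (s≤s _)) c∈k with mid-neighbour k-z
    ... | y , y∈k , refl with project p refl refl (AllPairs.tail kp!)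
    ...   | suc (suc i) , q , _ , _ =
      acyclic y c (suc (suc i)) q (s≤s (s≤s z≤n)) (endpoints-adj c∈k y∈k (≢-sym (path-ends-distinct q)))
    ...   | suc zero , q , _ , refl with two-step-walk p
    ...     | l , y∈l , c∈l , l∈p with joins-unique (endpoints-join y∈l c∈l (path-ends-distinct q))
                                                (endpoints-join y∈k c∈k (path-ends-distinct q))
    ...       | refl = Unique[x∷xs]⇒x∉xs kp! l∈p

    subdivision-acyclic : Acyclic S
    subdivision-acyclic u v j p 2≤j v-u with subdivision-adj v-u
    ... | k , c , c∈k , inj₁ (v≡c , u≡k) = cycle-through-mid⇒⊥ (subst (λ u′ → Path S u′ v j) u≡k p) v≡c 2≤j c∈k
    ... | k , c , c∈k , inj₂ (v≡k , u≡c) = cycle-through-mid⇒⊥ (subst (λ v′ → Path S v′ u j) v≡k (reversePath p)) u≡c 2≤j c∈k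

    subdivision-tree : IsTree S
    subdivision-tree = subdivision-simple , subdivision-connected , subdivision-acyclic

  sum-allFin : ∀ n (f : Fin n → ℕ) → sum (map f (allFin n)) ≡ ∑ f
  sum-allFin n f = trans (cong sum (map-tabulate (λ i → i) f)) (sum-tabulate n f)
    where
    sum-tabulate : ∀ n (f : Fin n → ℕ) → sum (tabulate f) ≡ ∑ f
    sum-tabulate zero    f = refl
    sum-tabulate (suc n) f = cong (f zero +_) (sum-tabulate n (λ i → f (suc i)))

  module _ {m n : ℕ} {x y : ℕ} where

    if-<ᵇ-yes : m < n → (if m <ᵇ n then x else y) ≡ x
    if-<ᵇ-yes m<n with m <ᵇ n | ℕ.<ᵇ-reflects-< m n
    ... | true  | _        = refl
    ... | false | ofⁿ m≮n = ⊥-elim (m≮n m<n)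

    if-<ᵇ-no : ¬ m < n → (if m <ᵇ n then x else y) ≡ y
    if-<ᵇ-no m≮n with m <ᵇ n | ℕ.<ᵇ-reflects-< m n
    ... | true  | ofʸ m<n = ⊥-elim (m≮n m<n)
    ... | false | _        = refl

  pairSum-double : ∀ G (f : Fin (V G) → Fin (V G) → ℕ) → (∀ u v → f u v ≡ f v u) → (∀ u → f u u ≡ 0) →
                   2 * pairSum G f ≡ ∑[ u < V G ] ∑[ v < V G ] f u v
  pairSum-double G f f-sym f-diag = begin
    2 * pairSum G f                                            ≡⟨ cong (2 *_) pairSum≡ ⟩
    P + (P + 0)                                                ≡⟨ cong (P +_) (trans (ℕ.+-identityʳ P) (∑-comm g)) ⟩
    P + ∑[ u < n ] ∑[ v < n ] g v u                            ≡⟨ ∑-distrib-+ (λ u → ∑[ v < n ] g u v) (λ u → ∑[ v < n ] g v u) ⟨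
    ∑[ u < n ] (∑[ v < n ] g u v + ∑[ v < n ] g v u)           ≡⟨ sum-cong-≗ (λ u → ∑-distrib-+ (g u) (λ v → g v u)) ⟨
    ∑[ u < n ] ∑[ v < n ] (g u v + g v u)                      ≡⟨ sum-cong-≗ (λ u → sum-cong-≗ (λ v → split u v)) ⟨
    ∑[ u < n ] ∑[ v < n ] f u v                                ∎
    where
    open ≡-Reasoning
    n = V G
    g : Fin n → Fin n → ℕ
    g u v = if toℕ u <ᵇ toℕ v then f u v else 0
    P = ∑[ u < n ] ∑[ v < n ] g u v
    pairSum≡ : pairSum G f ≡ P
    pairSum≡ = trans (sum-allFin n _) (sum-cong-≗ (λ u → sum-allFin n (g u)))
    split : ∀ u v → f u v ≡ g u v + g v u
    split u v with ℕ.<-cmp (toℕ u) (toℕ v)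
    ... | tri< u<v _ v≮u = sym (trans (cong₂ _+_ (if-<ᵇ-yes u<v) (if-<ᵇ-no v≮u)) (ℕ.+-identityʳ (f u v)))
    ... | tri> u≮v _ v<u = sym (trans (cong₂ _+_ (if-<ᵇ-no u≮v) (if-<ᵇ-yes v<u)) (f-sym v u))
    ... | tri≈ u≮v u≡v _ with toℕ-injective u≡v
    ...   | refl = trans (f-diag u) (sym (cong₂ _+_ (if-<ᵇ-no u≮v) (if-<ᵇ-no u≮v)))

  module SubdivisionDistance {G : Graph} (tree : IsTree G)
      (d : Fin (V G) → Fin (V G) → ℕ) (d-path : ∀ u v → Path G u v (d u v))
      (d′ : Fin (V (subdivide G)) → Fin (V (subdivide G)) → ℕ)
      (d′-path : ∀ u v → Path (subdivide G) u v (d′ u v)) where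

    open Subdivision tree
    open Edges tree using (m; a; b; edge-adj)
    open Tree.Distance tree d d-path using (d-sym)
    module S = Tree.Distance subdivision-tree d′ d′-path

    private
      n = V G

    d′-orig-orig : ∀ u v → d′ (orig u) (orig v) ≡ 2 * d u v
    d′-orig-orig u v with project (proj₁ (d′-path (orig u) (orig v))) refl refl (proj₂ (d′-path (orig u) (orig v)))
    ... | _ , q , _ , d′≡2j = trans d′≡2j (cong (2 *_) (Tree.Distance.path⇒d tree d d-path q))

    d′-around-mid : ∀ r k → mid k ≢ r → d′ r (orig (a k)) + d′ r (orig (b k)) ≡ 2 * d′ r (mid k)
    d′-around-mid r k mid≢r =
      S.midpoint mid≢r (mid-adj-orig (inj₁ refl)) (mid-adj-orig (inj₂ refl))
                 (λ e → Tree.adjacent⇒distinct tree (edge-adj k) (orig-injective e)) only-endpoints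
      where
      only-endpoints : ∀ z → Adj (subdivide G) (mid k) z → z ≡ orig (a k) ⊎ z ≡ orig (b k)
      only-endpoints z k-z with mid-neighbour k-z
      ... | _ , inj₁ refl , z≡orig = inj₁ z≡orig
      ... | _ , inj₂ refl , z≡orig = inj₂ z≡orig

    d′-orig-mid : ∀ x k → d′ (orig x) (mid k) ≡ d x (a k) + d x (b k)
    d′-orig-mid x k = ℕ.*-cancelˡ-≡ _ _ 2 (begin
      2 * d′ (orig x) (mid k)                                    ≡⟨ d′-around-mid (orig x) k (λ e → orig≢mid (sym e)) ⟨
      d′ (orig x) (orig (a k)) + d′ (orig x) (orig (b k))        ≡⟨ cong₂ _+_ (d′-orig-orig x (a k)) (d′-orig-orig x (b k)) ⟩
      2 * d x (a k) + 2 * d x (b k)                              ≡⟨ ℕ.*-distribˡ-+ 2 (d x (a k)) (d x (b k)) ⟨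
      2 * (d x (a k) + d x (b k))                                ∎)
      where open ≡-Reasoning

    d′-mid-endpoint : ∀ {k c} → Endpoint k c → d′ (mid k) (orig c) ≡ 1
    d′-mid-endpoint c∈k = sym (S.path⇒d (step (mid-adj-orig c∈k) here , ∷-unique (λ { (here e) → orig≢mid (sym e) }) ([] ∷ [])))

    distSum : Fin n → ℕ
    distSum x = ∑[ y < n ] d x y

    edgeDistSum : Fin n → ℕ
    edgeDistSum x = ∑[ k < m ] (d x (a k) + d x (b k))

    total : ℕ
    total = ∑[ x < n ] distSum x

    total′ : ℕ
    total′ = ∑[ r < n + m ] ∑[ s < n + m ] d′ r s

    orig-mid-total : ℕ
    orig-mid-total = ∑[ x < n ] edgeDistSum x

    mid-mid-total : ℕ
    mid-mid-total = ∑[ l < m ] ∑[ k < m ] d′ (mid l) (mid k)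

    edgeDistSum+m : ∀ x → edgeDistSum x + m ≡ 2 * distSum x
    edgeDistSum+m = Edges.Rooted.∑-endpoint-distances tree d d-path

    total′-split : total′ ≡ (2 * total + orig-mid-total) + (orig-mid-total + mid-mid-total)
    total′-split = begin
      total′
        ≡⟨ ∑-↑ n m (λ r → ∑[ s < n + m ] d′ r s) ⟩
      ∑[ x < n ] ∑[ s < n + m ] d′ (orig x) s + ∑[ l < m ] ∑[ s < n + m ] d′ (mid l) s
        ≡⟨ cong₂ _+_ (sum-cong-≗ (λ x → ∑-↑ n m (d′ (orig x)))) (sum-cong-≗ (λ l → ∑-↑ n m (d′ (mid l)))) ⟩
      ∑[ x < n ] (∑[ y < n ] d′ (orig x) (orig y) + ∑[ k < m ] d′ (orig x) (mid k))
        + ∑[ l < m ] (∑[ y < n ] d′ (mid l) (orig y) + ∑[ k < m ] d′ (mid l) (mid k))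
        ≡⟨ cong₂ _+_ (∑-distrib-+ (λ x → ∑[ y < n ] d′ (orig x) (orig y)) (λ x → ∑[ k < m ] d′ (orig x) (mid k)))
                     (∑-distrib-+ (λ l → ∑[ y < n ] d′ (mid l) (orig y)) (λ l → ∑[ k < m ] d′ (mid l) (mid k))) ⟩
      (∑[ x < n ] ∑[ y < n ] d′ (orig x) (orig y) + ∑[ x < n ] ∑[ k < m ] d′ (orig x) (mid k))
        + (∑[ l < m ] ∑[ y < n ] d′ (mid l) (orig y) + mid-mid-total)
        ≡⟨ cong₂ _+_ (cong₂ _+_ orig-orig orig-mid) (cong (_+ mid-mid-total) mid-orig) ⟩
      (2 * total + orig-mid-total) + (orig-mid-total + mid-mid-total)
        ∎
      where
      open ≡-Reasoning
      orig-orig : ∑[ x < n ] ∑[ y < n ] d′ (orig x) (orig y) ≡ 2 * total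
      orig-orig = trans (sum-cong-≗ (λ x → trans (sum-cong-≗ (d′-orig-orig x)) (∑-*ˡ n 2 (d x)))) (∑-*ˡ n 2 distSum)
      orig-mid : ∑[ x < n ] ∑[ k < m ] d′ (orig x) (mid k) ≡ orig-mid-total
      orig-mid = sum-cong-≗ (λ x → sum-cong-≗ (d′-orig-mid x))
      mid-orig : ∑[ l < m ] ∑[ y < n ] d′ (mid l) (orig y) ≡ orig-mid-total
      mid-orig = trans (sum-cong-≗ (λ l → sum-cong-≗ (λ y → S.d-sym (mid l) (orig y))))
                       (trans (∑-comm (λ l y → d′ (orig y) (mid l))) orig-mid)

    orig-mid-total+nm : orig-mid-total + n * m ≡ 2 * total
    orig-mid-total+nm = begin
      orig-mid-total + n * m                    ≡⟨ cong (orig-mid-total +_) (∑-const n m) ⟨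
      orig-mid-total + ∑[ x < n ] m             ≡⟨ ∑-distrib-+ edgeDistSum (λ _ → m) ⟨
      ∑[ x < n ] (edgeDistSum x + m)            ≡⟨ sum-cong-≗ edgeDistSum+m ⟩
      ∑[ x < n ] (2 * distSum x)                ≡⟨ ∑-*ˡ n 2 distSum ⟩
      2 * total                                 ∎
      where open ≡-Reasoning

    -- Both sides count Σₖ (edgeDistSum (a k) + edgeDistSum (b k)), once through the midpoints and
    -- once through the endpoints.
    mid-mid-total+m+m² : mid-mid-total + m + m * m ≡ orig-mid-total
    mid-mid-total+m+m² = ℕ.*-cancelˡ-≡ _ _ 2 (begin
      2 * (mid-mid-total + m + m * m)             ≡⟨ lemma mid-mid-total m ⟩
      (2 * mid-mid-total + m * 2) + 2 * (m * m)   ≡⟨ cong (_+ 2 * (m * m)) via-midpoints ⟨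
      X + 2 * (m * m)                             ≡⟨ via-endpoints ⟩
      2 * orig-mid-total                          ∎)
      where
      open ≡-Reasoning
      lemma : ∀ C m → 2 * (C + m + m * m) ≡ (2 * C + m * 2) + 2 * (m * m)
      lemma = solve-∀
      X : ℕ
      X = ∑[ k < m ] (edgeDistSum (a k) + edgeDistSum (b k))

      row : ∀ l → ∑[ k < m ] (d′ (mid l) (orig (a k)) + d′ (mid l) (orig (b k)))
                ≡ 2 * ∑[ k < m ] d′ (mid l) (mid k) + 2
      row l = trans (∑-≗-except _ (λ k → 2 * d′ (mid l) (mid k)) l 2 off-diagonal diagonal)
                    (cong (_+ 2) (∑-*ˡ m 2 (d′ (mid l) ∘ mid)))
        where
        off-diagonal : ∀ k → k ≢ l → d′ (mid l) (orig (a k)) + d′ (mid l) (orig (b k)) ≡ 2 * d′ (mid l) (mid k)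
        off-diagonal k k≢l = d′-around-mid (mid l) k (λ e → k≢l (mid-injective e))
        diagonal : d′ (mid l) (orig (a l)) + d′ (mid l) (orig (b l)) ≡ 2 * d′ (mid l) (mid l) + 2
        diagonal = trans (cong₂ _+_ (d′-mid-endpoint (inj₁ refl)) (d′-mid-endpoint (inj₂ refl)))
                         (cong (λ z → 2 * z + 2) (sym (S.d-diag (mid l))))

      via-midpoints : X ≡ 2 * mid-mid-total + m * 2
      via-midpoints = begin
        X
          ≡⟨ sum-cong-≗ (λ k → ∑-distrib-+ (λ l → d (a k) (a l) + d (a k) (b l)) (λ l → d (b k) (a l) + d (b k) (b l))) ⟨
        ∑[ k < m ] ∑[ l < m ] ((d (a k) (a l) + d (a k) (b l)) + (d (b k) (a l) + d (b k) (b l)))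
          ≡⟨ sum-cong-≗ (λ k → sum-cong-≗ (λ l → cong₂ _+_ (d′-orig-mid (a k) l) (d′-orig-mid (b k) l))) ⟨
        ∑[ k < m ] ∑[ l < m ] (d′ (orig (a k)) (mid l) + d′ (orig (b k)) (mid l))
          ≡⟨ ∑-comm (λ k l → d′ (orig (a k)) (mid l) + d′ (orig (b k)) (mid l)) ⟩
        ∑[ l < m ] ∑[ k < m ] (d′ (orig (a k)) (mid l) + d′ (orig (b k)) (mid l))
          ≡⟨ sum-cong-≗ (λ l → sum-cong-≗ (λ k → cong₂ _+_ (S.d-sym (orig (a k)) (mid l)) (S.d-sym (orig (b k)) (mid l)))) ⟩
        ∑[ l < m ] ∑[ k < m ] (d′ (mid l) (orig (a k)) + d′ (mid l) (orig (b k)))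
          ≡⟨ trans (sum-cong-≗ row) (∑-distrib-+ (λ l → 2 * ∑[ k < m ] d′ (mid l) (mid k)) (λ _ → 2)) ⟩
        ∑[ l < m ] (2 * ∑[ k < m ] d′ (mid l) (mid k)) + ∑[ l < m ] 2
          ≡⟨ cong₂ _+_ (∑-*ˡ m 2 (λ l → ∑[ k < m ] d′ (mid l) (mid k))) (∑-const m 2) ⟩
        2 * mid-mid-total + m * 2
          ∎

      via-endpoints : X + 2 * (m * m) ≡ 2 * orig-mid-total
      via-endpoints = begin
        X + 2 * (m * m)
          ≡⟨ cong (X +_) (trans (∑-const m (m + m)) (square m)) ⟨
        X + ∑[ k < m ] (m + m)
          ≡⟨ ∑-distrib-+ (λ k → edgeDistSum (a k) + edgeDistSum (b k)) (λ _ → m + m) ⟨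
        ∑[ k < m ] (edgeDistSum (a k) + edgeDistSum (b k) + (m + m))
          ≡⟨ sum-cong-≗ (λ k → per-edge (a k) (b k)) ⟩
        ∑[ k < m ] (2 * (distSum (a k) + distSum (b k)))
          ≡⟨ ∑-*ˡ m 2 (λ k → distSum (a k) + distSum (b k)) ⟩
        2 * ∑[ k < m ] (distSum (a k) + distSum (b k))
          ≡⟨ cong (2 *_) endpoints-distSum ⟩
        2 * orig-mid-total
          ∎
        where
        square : ∀ m → m * (m + m) ≡ 2 * (m * m)
        square = solve-∀
        rearrange : ∀ p q m → p + q + (m + m) ≡ (p + m) + (q + m)
        rearrange = solve-∀
        per-edge : ∀ x y → edgeDistSum x + edgeDistSum y + (m + m) ≡ 2 * (distSum x + distSum y)
        per-edge x y = trans (rearrange (edgeDistSum x) (edgeDistSum y) m)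
                             (trans (cong₂ _+_ (edgeDistSum+m x) (edgeDistSum+m y))
                                    (sym (ℕ.*-distribˡ-+ 2 (distSum x) (distSum y))))
        endpoints-distSum : ∑[ k < m ] (distSum (a k) + distSum (b k)) ≡ orig-mid-total
        endpoints-distSum = begin
          ∑[ k < m ] (distSum (a k) + distSum (b k))   ≡⟨ sum-cong-≗ (λ k → ∑-distrib-+ (d (a k)) (d (b k))) ⟨
          ∑[ k < m ] ∑[ y < n ] (d (a k) y + d (b k) y) ≡⟨ ∑-comm (λ k y → d (a k) y + d (b k) y) ⟩
          ∑[ y < n ] ∑[ k < m ] (d (a k) y + d (b k) y) ≡⟨ sum-cong-≗ (λ y → sum-cong-≗ (λ k →
                                                            cong₂ _+_ (d-sym (a k) y) (d-sym (b k) y))) ⟩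
          orig-mid-total                                ∎

    total′+4m[m+1] : suc m ≡ n → total′ + 4 * (m * (m + 1)) ≡ 8 * total
    total′+4m[m+1] 1+m≡n = ℕ.+-cancelʳ-≡ K _ _ (begin
      total′ + 4 * K + K
        ≡⟨ cong (λ t → t + 4 * K + K) total′-split ⟩
      (2 * total + B) + (B + C) + 4 * K + K
        ≡⟨ regroup₁ total B C m ⟩
      2 * total + 2 * B + (C + m + m * m) + 4 * K
        ≡⟨ cong (λ c → 2 * total + 2 * B + c + 4 * K) mid-mid-total+m+m² ⟩
      2 * total + 2 * B + B + 4 * K
        ≡⟨ regroup₂ total B m ⟩
      2 * total + 3 * (B + (1 + m) * m) + K
        ≡⟨ cong (λ x → 2 * total + 3 * (B + x * m) + K) 1+m≡n ⟩
      2 * total + 3 * (B + n * m) + K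
        ≡⟨ cong (λ x → 2 * total + 3 * x + K) orig-mid-total+nm ⟩
      2 * total + 3 * (2 * total) + K
        ≡⟨ regroup₃ total K ⟩
      8 * total + K
        ∎)
      where
      open ≡-Reasoning
      K = m * (m + 1)
      B = orig-mid-total
      C = mid-mid-total
      regroup₁ : ∀ T B C m → (2 * T + B) + (B + C) + 4 * (m * (m + 1)) + m * (m + 1)
                            ≡ 2 * T + 2 * B + (C + m + m * m) + 4 * (m * (m + 1))
      regroup₁ = solve-∀
      regroup₂ : ∀ T B m → 2 * T + 2 * B + B + 4 * (m * (m + 1)) ≡ 2 * T + 3 * (B + (1 + m) * m) + m * (m + 1)
      regroup₂ = solve-∀
      regroup₃ : ∀ T K → 2 * T + 3 * (2 * T) + K ≡ 8 * T + K
      regroup₃ = solve-∀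

    pairSum-total : 2 * pairSum G d ≡ total
    pairSum-total = pairSum-double G d d-sym (Tree.Distance.d-diag tree d d-path)

    pairSum-total′ : 2 * pairSum (subdivide G) d′ ≡ total′
    pairSum-total′ = pairSum-double (subdivide G) d′ S.d-sym S.d-diag

  tree-distance : ∀ {G} → IsTree G → Σ (Fin (V G) → Fin (V G) → ℕ) (λ d → ∀ u v → Path G u v (d u v))
  tree-distance (_ , connected , _) =
    (λ u v → proj₁ (walk⇒path (proj₂ (connected u v)))) , (λ u v → proj₁ (proj₂ (walk⇒path (proj₂ (connected u v)))))

  tree-edge-count : ∀ {G} → IsTree G → Fin (V G) → suc (length (E G)) ≡ V G
  tree-edge-count tree = Edges.Rooted.edge-count tree (proj₁ (tree-distance tree)) (proj₂ (tree-distance tree))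

  distanceSum-unique : ∀ {G s s′} → IsTree G → DistanceSum G s → DistanceSum G s′ → s ≡ s′
  distanceSum-unique {G} tree (d₁ , d₁-path , refl) (d₂ , d₂-path , refl) = ℕ.*-cancelˡ-≡ _ _ 2 (begin
    2 * pairSum G d₁                        ≡⟨ pairSum-double G d₁ D₁.d-sym D₁.d-diag ⟩
    ∑[ u < V G ] ∑[ v < V G ] d₁ u v        ≡⟨ sum-cong-≗ (λ u → sum-cong-≗ (λ v → Tree.path-length-unique tree (d₁-path u v) (d₂-path u v))) ⟩
    ∑[ u < V G ] ∑[ v < V G ] d₂ u v        ≡⟨ pairSum-double G d₂ D₂.d-sym D₂.d-diag ⟨
    2 * pairSum G d₂                        ∎)
    where
    open ≡-Reasoning
    module D₁ = Tree.Distance tree d₁ d₁-path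
    module D₂ = Tree.Distance tree d₂ d₂-path

  subdivide-edge-count : ∀ G → length (E (subdivide G)) ≡ 2 * length (E G)
  subdivide-edge-count (graph n es) = length-pairs (length es) _ _
    where
    length-pairs : ∀ {A : Set} k (f g : Fin k → A) → length (concat (tabulate (λ i → f i ∷ g i ∷ []))) ≡ 2 * k
    length-pairs zero    f g = refl
    length-pairs (suc k) f g = trans (cong (2 +_) (length-pairs k (f ∘ suc) (g ∘ suc))) (sym (ℕ.*-suc 2 k))

  subdivision-distanceSum : ∀ {G s s′} → IsTree G → suc (length (E G)) ≡ V G →
                            DistanceSum G s → DistanceSum (subdivide G) s′ →
                            s′ + 2 * (length (E G) * (length (E G) + 1)) ≡ 8 * s
  subdivision-distanceSum {G} {s} {s′} tree 1+m≡n (d , d-path , refl) (d′ , d′-path , refl) =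
    ℕ.*-cancelˡ-≡ _ _ 2 (begin
      2 * (s′ + 2 * K)         ≡⟨ ℕ.*-distribˡ-+ 2 s′ (2 * K) ⟩
      2 * s′ + 2 * (2 * K)     ≡⟨ cong₂ _+_ pairSum-total′ (sym (ℕ.*-assoc 2 2 K)) ⟩
      total′ + 4 * K           ≡⟨ total′+4m[m+1] 1+m≡n ⟩
      8 * total                ≡⟨ cong (8 *_) pairSum-total ⟨
      8 * (2 * s)              ≡⟨ swap s ⟩
      2 * (8 * s)              ∎)
    where
    open ≡-Reasoning
    swap : ∀ s → 8 * (2 * s) ≡ 2 * (8 * s)
    swap = solve-∀
    open SubdivisionDistance tree d d-path d′ d′-path
    K = length (E G) * (length (E G) + 1)

  closed-form : (s : ℕ → ℕ) (M : ℕ) →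
    (∀ t → s (suc t) + 2 * ((2 ^ t * M) * (2 ^ t * M + 1)) ≡ 8 * s t) →
    ∀ t → 6 * s t + 2 * 8 ^ t * M + 3 * 8 ^ t * (M * M)
        ≡ 6 * (8 ^ t * s 0) + 2 * 2 ^ t * M + 3 * (2 ^ t * 2 ^ t) * (M * M)
  closed-form s M recurrence zero = initial (s 0) M
    where
    initial : ∀ S M → 6 * S + 2 * 1 * M + 3 * 1 * (M * M) ≡ 6 * (1 * S) + 2 * 1 * M + 3 * (1 * 1) * (M * M)
    initial = solve-∀
  closed-form s M recurrence (suc t) = ℕ.+-cancelʳ-≡ (12 * K) _ _ (begin
    6 * s (suc t) + 2 * (8 * e) * M + 3 * (8 * e) * (M * M) + 12 * K
      ≡⟨ regroup₁ (s (suc t)) e p M ⟩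
    6 * (s (suc t) + 2 * K) + 16 * e * M + 24 * e * (M * M)
      ≡⟨ cong (λ x → 6 * x + 16 * e * M + 24 * e * (M * M)) (recurrence t) ⟩
    6 * (8 * s t) + 16 * e * M + 24 * e * (M * M)
      ≡⟨ regroup₂ (s t) e M ⟩
    8 * (6 * s t + 2 * e * M + 3 * e * (M * M))
      ≡⟨ cong (8 *_) (closed-form s M recurrence t) ⟩
    8 * (6 * (e * s 0) + 2 * p * M + 3 * (p * p) * (M * M))
      ≡⟨ regroup₃ (s 0) e p M ⟩
    6 * ((8 * e) * s 0) + 2 * (2 * p) * M + 3 * ((2 * p) * (2 * p)) * (M * M) + 12 * K
      ∎)
    where
    open ≡-Reasoning
    e = 8 ^ t
    p = 2 ^ t
    K = (p * M) * (p * M + 1)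
    regroup₁ : ∀ s′ e p M → 6 * s′ + 2 * (8 * e) * M + 3 * (8 * e) * (M * M) + 12 * ((p * M) * (p * M + 1))
                            ≡ 6 * (s′ + 2 * ((p * M) * (p * M + 1))) + 16 * e * M + 24 * e * (M * M)
    regroup₁ = solve-∀
    regroup₂ : ∀ s e M → 6 * (8 * s) + 16 * e * M + 24 * e * (M * M) ≡ 8 * (6 * s + 2 * e * M + 3 * e * (M * M))
    regroup₂ = solve-∀
    regroup₃ : ∀ S e p M → 8 * (6 * (e * S) + 2 * p * M + 3 * (p * p) * (M * M))
                           ≡ 6 * ((8 * e) * S) + 2 * (2 * p) * M + 3 * ((2 * p) * (2 * p)) * (M * M)
                             + 12 * ((p * M) * (p * M + 1))
    regroup₃ = solve-∀

  -- For t ≥ 1 the coefficients 3·8ᵗ and 3·4ᵗ are even, which is where 2^(3t-1) and 2^(2t-1) come from.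
  closed-form-positive : (s : ℕ → ℕ) (M : ℕ) →
    (∀ t → s (suc t) + 2 * ((2 ^ t * M) * (2 ^ t * M + 1)) ≡ 8 * s t) →
    ∀ t → 6 * s (suc t) + 2 * 2 ^ (3 * suc t) * M + 6 * 2 ^ (3 * suc t ∸ 1) * M ^ 2
          ≡ 6 * (8 ^ suc t * s 0) + 2 * 2 ^ suc t * M + 6 * 2 ^ (2 * suc t ∸ 1) * M ^ 2
  closed-form-positive s M recurrence t = begin
    6 * s (suc t) + 2 * 2 ^ (3 * suc t) * M + 6 * 2 ^ (3 * suc t ∸ 1) * M ^ 2
      ≡⟨ cong₂ (λ x y → 6 * s (suc t) + 2 * x * M + y * M ^ 2) 8^≡2^3* three-e ⟨
    6 * s (suc t) + 2 * 8 ^ suc t * M + 3 * 8 ^ suc t * M ^ 2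
      ≡⟨ cong (λ z → 6 * s (suc t) + 2 * 8 ^ suc t * M + 3 * 8 ^ suc t * z) square ⟨
    6 * s (suc t) + 2 * 8 ^ suc t * M + 3 * 8 ^ suc t * (M * M)
      ≡⟨ closed-form s M recurrence (suc t) ⟩
    6 * (8 ^ suc t * s 0) + 2 * p * M + 3 * (p * p) * (M * M)
      ≡⟨ cong₂ (λ y z → 6 * (8 ^ suc t * s 0) + 2 * p * M + y * z) three-pp square ⟩
    6 * (8 ^ suc t * s 0) + 2 * p * M + 6 * 2 ^ (2 * suc t ∸ 1) * M ^ 2
      ∎
    where
    open ≡-Reasoning
    p = 2 ^ suc t
    triple-double : ∀ x → 3 * (2 * x) ≡ 6 * x
    triple-double = solve-∀
    8^≡2^3* : 8 ^ suc t ≡ 2 ^ (3 * suc t)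
    8^≡2^3* = ℕ.^-*-assoc 2 3 (suc t)
    three-e : 3 * 8 ^ suc t ≡ 6 * 2 ^ (3 * suc t ∸ 1)
    three-e = trans (cong (3 *_) 8^≡2^3*) (triple-double (2 ^ (3 * suc t ∸ 1)))
    three-pp : 3 * (p * p) ≡ 6 * 2 ^ (2 * suc t ∸ 1)
    three-pp = trans (cong (3 *_) (trans (sym (ℕ.^-distribˡ-+-* 2 (suc t) (suc t)))
                                         (cong (λ k → 2 ^ (suc t + k)) (sym (ℕ.+-identityʳ (suc t))))))
                     (triple-double (2 ^ (2 * suc t ∸ 1)))
    square : M * M ≡ M ^ 2
    square = cong (M *_) (sym (ℕ.*-identityʳ M))

  module Iterated {T : Graph} (tree : IsTree T) where

    Tᵗ : ℕ → Graph
    Tᵗ t = subdivideTimes t T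

    iterate-tree : ∀ t → IsTree (Tᵗ t)
    iterate-tree zero    = tree
    iterate-tree (suc t) = Subdivision.subdivision-tree (iterate-tree t)

    iterate-edges : ∀ t → length (E (Tᵗ t)) ≡ 2 ^ t * length (E T)
    iterate-edges zero    = sym (ℕ.*-identityˡ (length (E T)))
    iterate-edges (suc t) = trans (subdivide-edge-count (Tᵗ t))
                                  (trans (cong (2 *_) (iterate-edges t)) (sym (ℕ.*-assoc 2 (2 ^ t) (length (E T)))))

    iterate-edge-count : suc (length (E T)) ≡ V T → ∀ t → suc (length (E (Tᵗ t))) ≡ V (Tᵗ t)
    iterate-edge-count base zero    = base
    iterate-edge-count base (suc t) = begin
      suc (length (E (subdivide (Tᵗ t))))   ≡⟨ cong suc (subdivide-edge-count (Tᵗ t)) ⟩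
      suc (2 * m)                           ≡⟨ cong suc (cong (m +_) (ℕ.+-identityʳ m)) ⟩
      suc m + m                             ≡⟨ cong (_+ m) (iterate-edge-count base t) ⟩
      V (Tᵗ t) + m                          ∎
      where
      open ≡-Reasoning
      m = length (E (Tᵗ t))

    distanceSum : ℕ → ℕ
    distanceSum t = pairSum (Tᵗ t) (proj₁ (tree-distance (iterate-tree t)))

    isDistanceSum : ∀ t → DistanceSum (Tᵗ t) (distanceSum t)
    isDistanceSum t = proj₁ (tree-distance (iterate-tree t)) , proj₂ (tree-distance (iterate-tree t)) , refl

    distanceSum-recurrence : suc (length (E T)) ≡ V T → ∀ t →
      distanceSum (suc t) + 2 * ((2 ^ t * length (E T)) * (2 ^ t * length (E T) + 1)) ≡ 8 * distanceSum t
    distanceSum-recurrence base t =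
      subst (λ m → distanceSum (suc t) + 2 * (m * (m + 1)) ≡ 8 * distanceSum t) (iterate-edges t)
            (subdivision-distanceSum (iterate-tree t) (iterate-edge-count base t) (isDistanceSum t) (isDistanceSum (suc t)))

open import Data.Nat using (ℕ; suc; _≤_; _∸_; _^_) renaming (_*_ to _*ℕ_; _+_ to _+ℕ_)
open import Data.Fin using (fromℕ<)
open import Data.List using (length)
open import Data.Integer using (+_) renaming (_+_ to _+ℤ_)
import Data.Integer.Properties as ℤ
open import Data.Rational using (ℚ; _/_; _+_; _-_; _*_; toℚᵘ)
open import Data.Rational.Properties using (toℚᵘ-injective; toℚᵘ-fromℚᵘ; toℚᵘ-homo-+; toℚᵘ-homo-*)
open import Data.Rational.Unnormalised using (mkℚᵘ; *≡*) renaming (_≃_ to _≃ᵘ_; _+_ to _+ᵘ_; _*_ to _*ᵘ_)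
import Data.Rational.Unnormalised.Properties as ℚᵘ
open import Data.Rational.Solver using (module +-*-Solver)
open import Relation.Binary.PropositionalEquality

fromℕ : ℕ → ℚ
fromℕ n = + n / 1

private
  toℚᵘ-fromℕ : ∀ n → toℚᵘ (fromℕ n) ≃ᵘ mkℚᵘ (+ n) 0
  toℚᵘ-fromℕ n = toℚᵘ-fromℚᵘ (mkℚᵘ (+ n) 0)

fromℕ-+ : ∀ a b → fromℕ (a +ℕ b) ≡ fromℕ a + fromℕ b
fromℕ-+ a b = toℚᵘ-injective (ℚᵘ.≃-trans (toℚᵘ-fromℕ (a +ℕ b)) (ℚᵘ.≃-trans ℕ-sum
  (ℚᵘ.≃-sym (ℚᵘ.≃-trans (toℚᵘ-homo-+ (fromℕ a) (fromℕ b)) (ℚᵘ.+-cong (toℚᵘ-fromℕ a) (toℚᵘ-fromℕ b))))))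
  where
  ℕ-sum : mkℚᵘ (+ (a +ℕ b)) 0 ≃ᵘ (mkℚᵘ (+ a) 0 +ᵘ mkℚᵘ (+ b) 0)
  ℕ-sum = *≡* (trans (ℤ.*-identityʳ _) (trans (ℤ.pos-+ a b)
                (sym (trans (ℤ.*-identityʳ _) (cong₂ _+ℤ_ (ℤ.*-identityʳ (+ a)) (ℤ.*-identityʳ (+ b)))))))

fromℕ-* : ∀ a b → fromℕ (a *ℕ b) ≡ fromℕ a * fromℕ b
fromℕ-* a b = toℚᵘ-injective (ℚᵘ.≃-trans (toℚᵘ-fromℕ (a *ℕ b)) (ℚᵘ.≃-trans ℕ-product
  (ℚᵘ.≃-sym (ℚᵘ.≃-trans (toℚᵘ-homo-* (fromℕ a) (fromℕ b)) (ℚᵘ.*-cong (toℚᵘ-fromℕ a) (toℚᵘ-fromℕ b))))))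
  where
  ℕ-product : mkℚᵘ (+ (a *ℕ b)) 0 ≃ᵘ (mkℚᵘ (+ a) 0 *ᵘ mkℚᵘ (+ b) 0)
  ℕ-product = *≡* (trans (ℤ.*-identityʳ _) (trans (ℤ.pos-* a b) (sym (ℤ.*-identityʳ _))))

rearrange-closed-form : ∀ X Y E P G H N N² →
  fromℕ 6 * X + fromℕ 2 * E * N + fromℕ 6 * G * N² ≡ fromℕ 6 * Y + fromℕ 2 * P * N + fromℕ 6 * H * N² →
  X ≡ (Y - (+ 1 / 3) * ((E - P) * N)) + ((H - G) * N²)
rearrange-closed-form X Y E P G H N N² eq = begin
  X
    ≡⟨ isolate X E G N N² ⟩
  + 1 / 6 * ((fromℕ 6 * X + fromℕ 2 * E * N + fromℕ 6 * G * N²) - fromℕ 2 * E * N - fromℕ 6 * G * N²)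
    ≡⟨ cong (λ z → + 1 / 6 * (z - fromℕ 2 * E * N - fromℕ 6 * G * N²)) eq ⟩
  + 1 / 6 * ((fromℕ 6 * Y + fromℕ 2 * P * N + fromℕ 6 * H * N²) - fromℕ 2 * E * N - fromℕ 6 * G * N²)
    ≡⟨ expand Y E P G H N N² ⟩
  (Y - (+ 1 / 3) * ((E - P) * N)) + ((H - G) * N²)
    ∎
  where
  open ≡-Reasoning
  open +-*-Solver
  isolate : ∀ X E G N N² →
    X ≡ + 1 / 6 * ((fromℕ 6 * X + fromℕ 2 * E * N + fromℕ 6 * G * N²) - fromℕ 2 * E * N - fromℕ 6 * G * N²)
  isolate = solve 5 (λ X E G N N² →
    X := con (+ 1 / 6) :* ((con (fromℕ 6) :* X :+ con (fromℕ 2) :* E :* N :+ con (fromℕ 6) :* G :* N²)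
                           :- con (fromℕ 2) :* E :* N :- con (fromℕ 6) :* G :* N²)) refl
  expand : ∀ Y E P G H N N² →
    + 1 / 6 * ((fromℕ 6 * Y + fromℕ 2 * P * N + fromℕ 6 * H * N²) - fromℕ 2 * E * N - fromℕ 6 * G * N²)
      ≡ (Y - (+ 1 / 3) * ((E - P) * N)) + ((H - G) * N²)
  expand = solve 7 (λ Y E P G H N N² →
    con (+ 1 / 6) :* ((con (fromℕ 6) :* Y :+ con (fromℕ 2) :* P :* N :+ con (fromℕ 6) :* H :* N²)
                      :- con (fromℕ 2) :* E :* N :- con (fromℕ 6) :* G :* N²)
    := (Y :- con (+ 1 / 3) :* ((E :- P) :* N)) :+ ((H :- G) :* N²)) refl

fromℕ-equation : ∀ a b c a′ b′ c′ N N² →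
  6 *ℕ a +ℕ 2 *ℕ b *ℕ N +ℕ 6 *ℕ c *ℕ N² ≡ 6 *ℕ a′ +ℕ 2 *ℕ b′ *ℕ N +ℕ 6 *ℕ c′ *ℕ N² →
  fromℕ 6 * fromℕ a + fromℕ 2 * fromℕ b * fromℕ N + fromℕ 6 * fromℕ c * fromℕ N²
    ≡ fromℕ 6 * fromℕ a′ + fromℕ 2 * fromℕ b′ * fromℕ N + fromℕ 6 * fromℕ c′ * fromℕ N²
fromℕ-equation a b c a′ b′ c′ N N² eq = trans (sym (shape a b c)) (trans (cong fromℕ eq) (shape a′ b′ c′))
  where
  shape : ∀ a b c → fromℕ (6 *ℕ a +ℕ 2 *ℕ b *ℕ N +ℕ 6 *ℕ c *ℕ N²)
                    ≡ fromℕ 6 * fromℕ a + fromℕ 2 * fromℕ b * fromℕ N + fromℕ 6 * fromℕ c * fromℕ N²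
  shape a b c =
    trans (fromℕ-+ (6 *ℕ a +ℕ 2 *ℕ b *ℕ N) (6 *ℕ c *ℕ N²))
          (cong₂ _+_ (trans (fromℕ-+ (6 *ℕ a) (2 *ℕ b *ℕ N))
                            (cong₂ _+_ (fromℕ-* 6 a) (trans (fromℕ-* (2 *ℕ b) N) (cong (_* fromℕ N) (fromℕ-* 2 b)))))
                     (trans (fromℕ-* (6 *ℕ c) N²) (cong (_* fromℕ N²) (fromℕ-* 6 c))))

closed-form-ℚ : ∀ S′ e g eS p h M M² →
  6 *ℕ S′ +ℕ 2 *ℕ e *ℕ M +ℕ 6 *ℕ g *ℕ M² ≡ 6 *ℕ eS +ℕ 2 *ℕ p *ℕ M +ℕ 6 *ℕ h *ℕ M² →
  fromℕ S′ ≡ (fromℕ eS - (+ 1 / 3) * ((fromℕ e - fromℕ p) * fromℕ M)) + ((fromℕ h - fromℕ g) * fromℕ M²)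
closed-form-ℚ S′ e g eS p h M M² eq =
  rearrange-closed-form (fromℕ S′) (fromℕ eS) (fromℕ e) (fromℕ p) (fromℕ g) (fromℕ h) (fromℕ M) (fromℕ M²)
                        (fromℕ-equation S′ e g eS p h M M² eq)

corollary1 : (T : Graph) → IsTree T → 2 ≤ V T → (t : ℕ) → 1 ≤ t →
    (S S′ : ℕ) → DistanceSum T S → DistanceSum (subdivideTimes t T) S′ →
    (+ S′ / 1) ≡
      ((+ (8 ^ t *ℕ S) / 1)
        - ((+ 1 / 3) * (((+ (2 ^ (3 *ℕ t)) / 1) - (+ (2 ^ t) / 1)) * (+ (V T ∸ 1) / 1))))
      + (((+ (2 ^ (2 *ℕ t ∸ 1)) / 1) - (+ (2 ^ (3 *ℕ t ∸ 1)) / 1)) * (+ ((V T ∸ 1) ^ 2) / 1))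
corollary1 T tree 2≤n (suc t) _ S S′ dsT dsTᵗ =
  closed-form-ℚ S′ (2 ^ (3 *ℕ suc t)) (2 ^ (3 *ℕ suc t ∸ 1)) (8 ^ suc t *ℕ S)
                   (2 ^ suc t) (2 ^ (2 *ℕ suc t ∸ 1)) (V T ∸ 1) ((V T ∸ 1) ^ 2) identity
  where
  open Iterated tree
  edge-count : suc (length (E T)) ≡ V T
  edge-count = tree-edge-count tree (fromℕ< 2≤n)
  identity : 6 *ℕ S′ +ℕ 2 *ℕ 2 ^ (3 *ℕ suc t) *ℕ (V T ∸ 1) +ℕ 6 *ℕ 2 ^ (3 *ℕ suc t ∸ 1) *ℕ (V T ∸ 1) ^ 2
             ≡ 6 *ℕ (8 ^ suc t *ℕ S) +ℕ 2 *ℕ 2 ^ suc t *ℕ (V T ∸ 1) +ℕ 6 *ℕ 2 ^ (2 *ℕ suc t ∸ 1) *ℕ (V T ∸ 1) ^ 2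
  identity rewrite distanceSum-unique (iterate-tree (suc t)) dsTᵗ (isDistanceSum (suc t))
                 | distanceSum-unique tree dsT (isDistanceSum 0)
                 | sym (cong (_∸ 1) edge-count) =
    closed-form-positive distanceSum (length (E T)) (distanceSum-recurrence edge-count) t
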